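{- In any execution of Algorithm 1 (described in the context), for every node $v$ there is some iteration where $\rho_{cw}(v)\ge\mathrm{ID}(v)$ holds.
   Context: Oriented ring of $n$ nodes, content-oblivious asynchronous model (content-free pulses, delivered after arbitrary finite delays, never lost or injected; each node has an incoming queue per port). Each node $v$ has a unique positive integer ID $\mathrm{ID}(v)$. $\rho_{cw}(v)$ and $\sigma_{cw}(v)$ are the numbers of clockwise (CW) pulses node $v$ has received (consumed from its queue) and sent, initially 0. Algorithm 1 at node $v$: first send one CW pulse; then loop forever: if a CW pulse is waiting, consume it (incrementing $\rho_{cw}(v)$); then if $\rho_{cw}(v)=\mathrm{ID}(v)$ set state to Leader and send nothing, otherwise set state to Non-Leader and send one CW pulse. -}

module Defs where

open import Data.Nat using (ℕ; zero; suc; _+_; _∸_; _≤_; _<_; _≡ᵇ_)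
open import Data.Nat.DivMod using (_%_; m%n<n)
open import Data.Fin using (Fin; toℕ; fromℕ<; _≟_)
open import Data.Bool using (Bool; true; false; if_then_else_)
open import Relation.Nullary using (does)
open import Data.Product using (Σ; _×_)
open import Relation.Binary.PropositionalEquality using (_≡_)

-- Oriented ring of n = suc m nodes, nodes are Fin (suc m).
-- The clockwise out-port of node i is connected to the clockwise
-- in-port of node (i + 1) mod n.
cwNext : ∀ {m} → Fin (suc m) → Fin (suc m)
cwNext {m} i = fromℕ< (m%n<n (suc (toℕ i)) (suc m))

update : ∀ {n} {A : Set} → (Fin n → A) → Fin n → (A → A) → (Fin n → A)
update f i g j = if does (j ≟ i) then g (f j) else f j

data Status : Set where
  Undecided Leader NonLeader : Status

record Config (n : ℕ) : Set where
  field
    started : Fin n → Bool     -- has the node performed its initial send?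
    ρcw     : Fin n → ℕ        -- CW pulses received (consumed from queue)
    σcw     : Fin n → ℕ        -- CW pulses sent
    status  : Fin n → Status
    transit : Fin n → ℕ        -- CW pulses in transit towards node i (sent, not yet delivered)
    queue   : Fin n → ℕ        -- CW pulses delivered into i's incoming queue, not yet consumed
open Config public

initConfig : ∀ n → Config n
initConfig n = record
  { started = λ _ → false ; ρcw = λ _ → 0 ; σcw = λ _ → 0
  ; status = λ _ → Undecided ; transit = λ _ → 0 ; queue = λ _ → 0 }

data Event (n : ℕ) : Set where
  deliver : Fin n → Event n   -- deliver one in-transit CW pulse into node i's queue
  step    : Fin n → Event n

sendCW : ∀ {m} → Fin (suc m) → Config (suc m) → Config (suc m)
sendCW i c = record c
  { σcw = update (σcw c) i suc ; transit = update (transit c) (cwNext i) suc }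

-- One step of Algorithm 1 at node i: the first step sends one CW pulse;
-- every later step is one loop iteration: if a CW pulse is waiting, consume
-- it, then become Leader (send nothing) if ρ = ID, else become Non-Leader
-- and send one CW pulse.
nodeStep : ∀ {m} → (Fin (suc m) → ℕ) → Fin (suc m) → Config (suc m) → Config (suc m)
nodeStep ID i c with started c i
... | false = sendCW i (record c { started = update (started c) i (λ _ → true) })
... | true with queue c i
...   | zero = c
...   | suc _ =
  let c' = record c { queue = update (queue c) i (_∸ 1) ; ρcw = update (ρcw c) i suc }
  in if ρcw c' i ≡ᵇ ID i
     then record c' { status = update (status c') i (λ _ → Leader) }
     else sendCW i (record c' { status = update (status c') i (λ _ → NonLeader) })

deliverStep : ∀ {n} → Fin n → Config n → Config n
deliverStep i c with transit c i
... | zero = c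
... | suc _ = record c { transit = update (transit c) i (_∸ 1) ; queue = update (queue c) i suc }

apply : ∀ {m} → (Fin (suc m) → ℕ) → Event (suc m) → Config (suc m) → Config (suc m)
apply ID (deliver i) c = deliverStep i c
apply ID (step i) c = nodeStep ID i c

run : ∀ {m} → (Fin (suc m) → ℕ) → (ℕ → Event (suc m)) → ℕ → Config (suc m)
run {m} ID e zero = initConfig (suc m)
run ID e (suc t) = apply ID (e t) (run ID e t)

-- Fairness of an asynchronous execution:
-- every node takes infinitely many steps (it loops forever), and
-- every pulse in transit is eventually delivered (no pulse is lost).
record Fair {m} (ID : Fin (suc m) → ℕ) (e : ℕ → Event (suc m)) : Set where
  field
    nodesFair    : ∀ (i : Fin (suc m)) (t : ℕ) → Σ ℕ (λ t' → t ≤ t' × e t' ≡ step i)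
    deliveryFair : ∀ (i : Fin (suc m)) (t : ℕ) → 0 < transit (run ID e t) i →
                   Σ ℕ (λ t' → t ≤ t' × e t' ≡ deliver i)

-- Once started, a node has sent one pulse more than it has consumed while ρ < ID, and exactly
-- as many afterwards; and every pulse sent by u is in transit to, queued at, or consumed by
-- its clockwise successor. Hence in a configuration where nothing is pending (every node has
-- started and all channels are empty), ρ never decreases along the ring and grows by one at
-- any node with ρ < ID; going once around the ring, no such node can exist.
-- So while ρ(v) < ID(v) some node x has pending work. By fairness x eventually acts; if it
-- forwards a pulse its successor has pending work, and following that pulse towards v either
-- the potential Σᵤ ([u not started] + (ID u ∸ ρ u)) strictly drops, or the pulse reaches v
-- when ρ(v) ≥ ID(v). The potential is a natural number, so the latter eventually happens.
module Submission where

open import Defs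
open import Data.Nat
  using (ℕ; zero; suc; _+_; _∸_; _≤_; _<_; _≤′_; ≤′-refl; ≤′-step; _≤?_; _≡ᵇ_; NonZero; z≤n; s≤s; z<s)
open import Data.Nat.Properties
  using (+-0-monoid; +-assoc; +-suc; +-identityʳ; +-comm; +-mono-≤; +-mono-<-≤; +-mono-≤-<;
         ≤-refl; ≤-reflexive; <⇒≤; n<1+n; 1+n≰n; <⇒≱; ≤-trans; <-≤-trans; <-irrefl; n≤1+n; m≤n⇒m≤1+n;
         ≤∧≢⇒<; ≮⇒≥; n≤0⇒n≡0; ≡ᵇ⇒≡; ≡⇒≡ᵇ; m+[n∸m]≡n; m∸n+n≡m; ∸-monoʳ-≤; ∸-monoʳ-<; ≤⇒≤′;
         _<?_; module ≤-Reasoning)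
open import Data.Nat.DivMod using (_%_; m%n<n; m%n%n≡m%n; %-distribˡ-+; [m+n]%n≡m%n; m<n⇒m%n≡m)
open import Data.Nat.Induction using (<-wellFounded)
open import Data.Fin using (Fin; zero; suc; toℕ; _≟_)
open import Data.Fin.Properties using (toℕ-fromℕ<; toℕ-injective; toℕ<n; any?)
open import Data.Bool using (Bool; true; false; T)
open import Data.Bool.Properties using () renaming (_≟_ to _≟ᵇ_)
open import Data.Unit using (tt)
open import Data.Product using (Σ; ∃; _×_; _,_)
open import Data.Sum using (_⊎_; inj₁; inj₂; map₁)
open import Function using (_∘_; id)
open import Function.Definitions using (Injective)
open import Induction.WellFounded using (Acc; acc)
open import Relation.Nullary using (Dec; yes; no; ¬_; contradiction)
open import Relation.Nullary.Decidable using (map′; _⊎-dec_)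
open import Relation.Binary.PropositionalEquality
  using (_≡_; _≢_; refl; sym; trans; cong; cong₂; subst; subst₂; module ≡-Reasoning)
open import Algebra.Properties.Monoid.Sum +-0-monoid using (sum)

-- The ring

cwNext^ : ∀ {m} → ℕ → Fin (suc m) → Fin (suc m)
cwNext^ zero    x = x
cwNext^ (suc d) x = cwNext^ d (cwNext x)

[m%n+k]%n≡[m+k]%n : ∀ m k n .{{_ : NonZero n}} → (m % n + k) % n ≡ (m + k) % n
[m%n+k]%n≡[m+k]%n m k n = begin
  (m % n + k) % n           ≡⟨ %-distribˡ-+ (m % n) k n ⟩
  (m % n % n + k % n) % n   ≡⟨ cong (λ z → (z + k % n) % n) (m%n%n≡m%n m n) ⟩
  (m % n + k % n) % n       ≡⟨ sym (%-distribˡ-+ m k n) ⟩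
  (m + k) % n               ∎
  where open ≡-Reasoning

toℕ-cwNext^ : ∀ {m} d (x : Fin (suc m)) → toℕ (cwNext^ d x) ≡ (toℕ x + d) % suc m
toℕ-cwNext^ {m} zero x =
  sym (trans (cong (_% suc m) (+-identityʳ (toℕ x))) (m<n⇒m%n≡m (toℕ<n x)))
toℕ-cwNext^ {m} (suc d) x = begin
  toℕ (cwNext^ d (cwNext x))          ≡⟨ toℕ-cwNext^ d (cwNext x) ⟩
  (toℕ (cwNext x) + d) % suc m        ≡⟨ cong (λ z → (z + d) % suc m) (toℕ-fromℕ< (m%n<n (suc (toℕ x)) (suc m))) ⟩
  (suc (toℕ x) % suc m + d) % suc m   ≡⟨ [m%n+k]%n≡[m+k]%n (suc (toℕ x)) d (suc m) ⟩
  (suc (toℕ x) + d) % suc m           ≡⟨ cong (_% suc m) (sym (+-suc (toℕ x) d)) ⟩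
  (toℕ x + suc d) % suc m             ∎
  where open ≡-Reasoning

cwNext^-period : ∀ {m} (x : Fin (suc m)) → cwNext^ (suc m) x ≡ x
cwNext^-period {m} x = toℕ-injective (begin
  toℕ (cwNext^ (suc m) x)    ≡⟨ toℕ-cwNext^ (suc m) x ⟩
  (toℕ x + suc m) % suc m    ≡⟨ [m+n]%n≡m%n (toℕ x) (suc m) ⟩
  toℕ x % suc m              ≡⟨ m<n⇒m%n≡m (toℕ<n x) ⟩
  toℕ x                      ∎)
  where open ≡-Reasoning

cwNext-injective : ∀ {m} {x y : Fin (suc m)} → cwNext x ≡ cwNext y → x ≡ y
cwNext-injective {m} {x} {y} eq =
  trans (sym (cwNext^-period x)) (trans (cong (cwNext^ m) eq) (cwNext^-period y))

cwNext^-reaches : ∀ {m} (x y : Fin (suc m)) → ∃ λ d → cwNext^ d x ≡ y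
cwNext^-reaches {m} x y = (suc m ∸ toℕ x) + toℕ y , toℕ-injective (begin
  toℕ (cwNext^ ((suc m ∸ toℕ x) + toℕ y) x)    ≡⟨ toℕ-cwNext^ _ x ⟩
  (toℕ x + ((suc m ∸ toℕ x) + toℕ y)) % suc m  ≡⟨ cong (_% suc m) (sym (+-assoc (toℕ x) _ (toℕ y))) ⟩
  (toℕ x + (suc m ∸ toℕ x) + toℕ y) % suc m    ≡⟨ cong (λ z → (z + toℕ y) % suc m) (m+[n∸m]≡n (<⇒≤ (toℕ<n x))) ⟩
  (suc m + toℕ y) % suc m                      ≡⟨ cong (_% suc m) (+-comm (suc m) (toℕ y)) ⟩
  (toℕ y + suc m) % suc m                      ≡⟨ [m+n]%n≡m%n (toℕ y) (suc m) ⟩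
  toℕ y % suc m                                ≡⟨ m<n⇒m%n≡m (toℕ<n y) ⟩
  toℕ y                                        ∎)
  where open ≡-Reasoning

ring-no-ascent : ∀ {m} (f : Fin (suc m) → ℕ) → (∀ u → f u ≤ f (cwNext u)) → ∀ v → f (cwNext v) ≤ f v
ring-no-ascent f nondecreasing v with cwNext^-reaches (cwNext v) v
... | d , reaches = subst (λ y → f (cwNext v) ≤ f y) reaches (along d (cwNext v))
  where
  along : ∀ d u → f u ≤ f (cwNext^ d u)
  along zero    u = ≤-refl
  along (suc d) u = ≤-trans (nondecreasing u) (along d (cwNext u))

sum-mono-≤ : ∀ {n} {f g : Fin n → ℕ} → (∀ u → f u ≤ g u) → sum f ≤ sum g
sum-mono-≤ {zero}  f≤g = z≤n
sum-mono-≤ {suc n} f≤g = +-mono-≤ (f≤g zero) (sum-mono-≤ (f≤g ∘ suc))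

sum-mono-< : ∀ {n} {f g : Fin n → ℕ} → (∀ u → f u ≤ g u) → ∀ w → f w < g w → sum f < sum g
sum-mono-< {suc n} f≤g zero    fw<gw = +-mono-<-≤ fw<gw (sum-mono-≤ (f≤g ∘ suc))
sum-mono-< {suc n} f≤g (suc w) fw<gw = +-mono-≤-< (f≤g zero) (sum-mono-< (f≤g ∘ suc) w fw<gw)

update-≡ : ∀ {n} {A : Set} (f : Fin n → A) i g → update f i g i ≡ g (f i)
update-≡ f i g with i ≟ i
... | yes _   = refl
... | no i≢i = contradiction refl i≢i

update-≢ : ∀ {n} {A : Set} (f : Fin n → A) i g {j} → j ≢ i → update f i g j ≡ f j
update-≢ f i g {j} j≢i with j ≟ i
... | yes j≡i = contradiction j≡i j≢i
... | no _    = refl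

update-suc-≥ : ∀ {n} (f : Fin n → ℕ) i j → f j ≤ update f i suc j
update-suc-≥ f i j with j ≟ i
... | yes refl = n≤1+n (f j)
... | no _     = ≤-refl

update-transfer : ∀ {n} (f g : Fin n → ℕ) i → 0 < f i →
                  ∀ j → update f i (_∸ 1) j + update g i suc j ≡ f j + g j
update-transfer f g i 0<fi j with j ≟ i
... | yes refl = trans (+-suc (f j ∸ 1) (g j)) (cong (_+ g j) (m+[n∸m]≡n 0<fi))
... | no _     = refl

-- One step of a node

markStarted : ∀ {n} → Fin n → Config n → Config n
markStarted i c = record c { started = update (started c) i (λ _ → true) }

consume : ∀ {n} → Fin n → Config n → Config n
consume i c = record c { queue = update (queue c) i (_∸ 1) ; ρcw = update (ρcw c) i suc }

decide : ∀ {n} → Fin n → Status → Config n → Config n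
decide i s c = record c { status = update (status c) i (λ _ → s) }

data StepView {m} (ID : Fin (suc m) → ℕ) (i : Fin (suc m)) (c : Config (suc m)) :
     Config (suc m) → Set where
  starts : started c i ≡ false → StepView ID i c (sendCW i (markStarted i c))
  idles  : started c i ≡ true → queue c i ≡ 0 → StepView ID i c c
  elects : started c i ≡ true → 0 < queue c i → suc (ρcw c i) ≡ ID i →
           StepView ID i c (decide i Leader (consume i c))
  relays : started c i ≡ true → 0 < queue c i → suc (ρcw c i) ≢ ID i →
           StepView ID i c (sendCW i (decide i NonLeader (consume i c)))

stepView : ∀ {m} (ID : Fin (suc m) → ℕ) i c → StepView ID i c (nodeStep ID i c)
stepView ID i c with started c i in started≡
... | false = starts started≡
... | true with queue c i in queue≡
...   | zero  = idles started≡ queue≡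
...   | suc _ with update (ρcw c) i suc i ≡ᵇ ID i in decision
...     | true  = elects started≡ 0<queue (trans (sym (update-≡ (ρcw c) i suc))
                                                 (≡ᵇ⇒≡ _ _ (subst T (sym decision) tt)))
  where
  0<queue : 0 < queue c i
  0<queue = subst (0 <_) (sym queue≡) z<s
...     | false = relays started≡ 0<queue (λ eq → subst T decision
                    (≡⇒≡ᵇ _ _ (trans (update-≡ (ρcw c) i suc) eq)))
  where
  0<queue : 0 < queue c i
  0<queue = subst (0 <_) (sym queue≡) z<s

arrive : ∀ {n} → Fin n → Config n → Config n
arrive i c = record c { transit = update (transit c) i (_∸ 1) ; queue = update (queue c) i suc }

data DeliverView {n} (i : Fin n) (c : Config n) : Config n → Set where
  empty : transit c i ≡ 0 → DeliverView i c c
  moves : 0 < transit c i → DeliverView i c (arrive i c)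

deliverView : ∀ {n} (i : Fin n) c → DeliverView i c (deliverStep i c)
deliverView i c with transit c i in transit≡
... | zero  = empty transit≡
... | suc _ = moves (subst (0 <_) (sym transit≡) z<s)

-- Invariants

data NodeInv (id : ℕ) : Bool → ℕ → ℕ → Set where
  unstarted : NodeInv id false 0 0
  below     : ∀ {r} → r < id → NodeInv id true r (suc r)
  reached   : ∀ {r} → id ≤ r → NodeInv id true r r

NodeInvariant : ∀ {n} → (Fin n → ℕ) → Config n → Fin n → Set
NodeInvariant ID c u = NodeInv (ID u) (started c u) (ρcw c u) (σcw c u)

nodeInv-start : ∀ {id s r σ} → 0 < id → s ≡ false → NodeInv id s r σ → NodeInv id true r (suc σ)
nodeInv-start 0<id refl unstarted = below 0<id

nodeInv-elect : ∀ {id s r σ} → s ≡ true → suc r ≡ id → NodeInv id s r σ → NodeInv id s (suc r) σ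
nodeInv-elect refl 1+r≡id (below _)     = reached (≤-reflexive (sym 1+r≡id))
nodeInv-elect refl 1+r≡id (reached id≤r) = contradiction (≤-trans (≤-reflexive 1+r≡id) id≤r) 1+n≰n

nodeInv-relay : ∀ {id s r σ} → s ≡ true → suc r ≢ id → NodeInv id s r σ → NodeInv id s (suc r) (suc σ)
nodeInv-relay refl 1+r≢id (below r<id)   = below (≤∧≢⇒< r<id 1+r≢id)
nodeInv-relay refl 1+r≢id (reached id≤r) = reached (m≤n⇒m≤1+n id≤r)

nodeInv-sent≥received : ∀ {id s r σ} → NodeInv id s r σ → r ≤ σ
nodeInv-sent≥received unstarted   = z≤n
nodeInv-sent≥received (below _)   = n≤1+n _
nodeInv-sent≥received (reached _) = ≤-refl

nodeInv-below : ∀ {id s r σ} → s ≡ true → r < id → NodeInv id s r σ → σ ≡ suc r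
nodeInv-below refl r<id (below _)      = refl
nodeInv-below refl r<id (reached id≤r) = contradiction id≤r (<⇒≱ r<id)

nodeInvariant-step : ∀ {m} {ID : Fin (suc m) → ℕ} → (∀ u → 0 < ID u) →
                     ∀ {i c c'} → StepView ID i c c' → ∀ u → NodeInvariant ID c u → NodeInvariant ID c' u
nodeInvariant-step ID-pos {i} (starts unstarted≡) u inv with u ≟ i
... | yes refl = nodeInv-start (ID-pos u) unstarted≡ inv
... | no _     = inv
nodeInvariant-step ID-pos (idles _ _) u inv = inv
nodeInvariant-step ID-pos {i} (elects started≡ _ 1+ρ≡ID) u inv with u ≟ i
... | yes refl = nodeInv-elect started≡ 1+ρ≡ID inv
... | no _     = inv
nodeInvariant-step ID-pos {i} (relays started≡ _ 1+ρ≢ID) u inv with u ≟ i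
... | yes refl = nodeInv-relay started≡ 1+ρ≢ID inv
... | no _     = inv

inflow : ∀ {n} → Config n → Fin n → ℕ
inflow c w = transit c w + queue c w + ρcw c w

Conservation : ∀ {m} → Config (suc m) → Set
Conservation c = ∀ u → inflow c (cwNext u) ≡ σcw c u

record Silent {n} (c d : Config n) : Set where
  field
    same-inflow : ∀ w → inflow d w ≡ inflow c w
    same-sent   : ∀ u → σcw d u ≡ σcw c u

silent-consume : ∀ {n} (i : Fin n) c → 0 < queue c i → Silent c (consume i c)
silent-consume i c 0<queue = record { same-inflow = moved ; same-sent = λ _ → refl }
  where
  moved : ∀ w → inflow (consume i c) w ≡ inflow c w
  moved w = begin
    transit c w + update (queue c) i (_∸ 1) w + update (ρcw c) i suc w
      ≡⟨ +-assoc (transit c w) _ _ ⟩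
    transit c w + (update (queue c) i (_∸ 1) w + update (ρcw c) i suc w)
      ≡⟨ cong (transit c w +_) (update-transfer (queue c) (ρcw c) i 0<queue w) ⟩
    transit c w + (queue c w + ρcw c w)
      ≡⟨ sym (+-assoc (transit c w) _ _) ⟩
    inflow c w ∎
    where open ≡-Reasoning

silent-arrive : ∀ {n} (i : Fin n) c → 0 < transit c i → Silent c (arrive i c)
silent-arrive i c 0<transit = record
  { same-inflow = λ w → cong (_+ ρcw c w) (update-transfer (transit c) (queue c) i 0<transit w)
  ; same-sent   = λ _ → refl }

conservation-silent : ∀ {m} {c d : Config (suc m)} → Silent c d → Conservation c → Conservation d
conservation-silent silent conserved u =
  trans (same-inflow _) (trans (conserved u) (sym (same-sent u)))
  where open Silent silent

conservation-send : ∀ {m} (i : Fin (suc m)) c → Conservation c → Conservation (sendCW i c)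
conservation-send i c conserved u with u ≟ i
... | yes refl = trans (cong (λ t → t + queue c (cwNext u) + ρcw c (cwNext u)) (update-≡ (transit c) (cwNext u) suc))
                       (cong suc (conserved u))
... | no u≢i   = trans (cong (λ t → t + queue c (cwNext u) + ρcw c (cwNext u))
                             (update-≢ (transit c) (cwNext i) suc (u≢i ∘ cwNext-injective)))
                       (conserved u)

conservation-step : ∀ {m} {ID : Fin (suc m) → ℕ} {i c c'} → StepView ID i c c' → Conservation c → Conservation c'
conservation-step {i = i} {c} (starts _) = conservation-send i (markStarted i c)
conservation-step (idles _ _) = id
conservation-step {i = i} {c} (elects _ 0<queue _) = conservation-silent (silent-consume i c 0<queue)
conservation-step {i = i} {c} (relays _ 0<queue _) =
  conservation-send i (decide i NonLeader (consume i c)) ∘ conservation-silent (silent-consume i c 0<queue)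

conservation-deliver : ∀ {m} {i : Fin (suc m)} {c c'} → DeliverView i c c' → Conservation c → Conservation c'
conservation-deliver (empty _) = id
conservation-deliver {i = i} {c} (moves 0<transit) = conservation-silent (silent-arrive i c 0<transit)

-- The potential

record _⊑_ {n} (c d : Config n) : Set where
  field
    started-kept : ∀ u → started c u ≡ true → started d u ≡ true
    ρcw-mono     : ∀ u → ρcw c u ≤ ρcw d u
open _⊑_

⊑-refl : ∀ {n} {c : Config n} → c ⊑ c
⊑-refl = record { started-kept = λ _ → id ; ρcw-mono = λ _ → ≤-refl }

⊑-trans : ∀ {n} {c d e : Config n} → c ⊑ d → d ⊑ e → c ⊑ e
⊑-trans c⊑d d⊑e = record
  { started-kept = λ u → started-kept d⊑e u ∘ started-kept c⊑d u
  ; ρcw-mono     = λ u → ≤-trans (ρcw-mono c⊑d u) (ρcw-mono d⊑e u) }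

step-⊑ : ∀ {m} {ID : Fin (suc m) → ℕ} {i c c'} → StepView ID i c c' → c ⊑ c'
step-⊑ {i = i} {c} (starts _) = record { started-kept = kept ; ρcw-mono = λ _ → ≤-refl }
  where
  kept : ∀ u → started c u ≡ true → update (started c) i (λ _ → true) u ≡ true
  kept u with u ≟ i
  ... | yes _ = λ _ → refl
  ... | no _  = id
step-⊑ (idles _ _) = ⊑-refl
step-⊑ {i = i} {c} (elects _ _ _) = record { started-kept = λ _ → id ; ρcw-mono = update-suc-≥ (ρcw c) i }
step-⊑ {i = i} {c} (relays _ _ _) = record { started-kept = λ _ → id ; ρcw-mono = update-suc-≥ (ρcw c) i }

apply-⊑ : ∀ {m} (ID : Fin (suc m) → ℕ) ev c → c ⊑ apply ID ev c
apply-⊑ ID (deliver i) c with deliverStep i c | deliverView i c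
... | _ | empty _ = ⊑-refl
... | _ | moves _ = record { started-kept = λ _ → id ; ρcw-mono = λ _ → ≤-refl }
apply-⊑ ID (step i) c = step-⊑ (stepView ID i c)

nodePotential : ℕ → Bool → ℕ → ℕ
nodePotential id false r = suc (id ∸ r)
nodePotential id true  r = id ∸ r

potential : ∀ {n} → (Fin n → ℕ) → Config n → ℕ
potential ID c = sum λ u → nodePotential (ID u) (started c u) (ρcw c u)

nodePotential-anti : ∀ id {s s' r r'} → (s ≡ true → s' ≡ true) → r ≤ r' →
                     nodePotential id s' r' ≤ nodePotential id s r
nodePotential-anti id {true}  {true}  _ r≤r' = ∸-monoʳ-≤ id r≤r'
nodePotential-anti id {true}  {false} kept _ with () ← kept refl
nodePotential-anti id {false} {true}  _ r≤r' = m≤n⇒m≤1+n (∸-monoʳ-≤ id r≤r')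
nodePotential-anti id {false} {false} _ r≤r' = s≤s (∸-monoʳ-≤ id r≤r')

nodePotential-consume : ∀ {n id s} (ρ : Fin n → ℕ) x → s ≡ true → ρ x < id →
                        nodePotential id s (update ρ x suc x) < nodePotential id s (ρ x)
nodePotential-consume {id = id} ρ x refl ρ<id =
  subst (λ r → id ∸ r < id ∸ ρ x) (sym (update-≡ ρ x suc)) (∸-monoʳ-< (n<1+n (ρ x)) ρ<id)

potential-anti : ∀ {n} (ID : Fin n → ℕ) {c d} → c ⊑ d → potential ID d ≤ potential ID c
potential-anti ID c⊑d = sum-mono-≤ λ u → nodePotential-anti (ID u) (started-kept c⊑d u) (ρcw-mono c⊑d u)

potential-strict : ∀ {n} (ID : Fin n → ℕ) {c d} → c ⊑ d → ∀ x →
                   nodePotential (ID x) (started d x) (ρcw d x) < nodePotential (ID x) (started c x) (ρcw c x) →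
                   potential ID d < potential ID c
potential-strict ID c⊑d =
  sum-mono-< λ u → nodePotential-anti (ID u) (started-kept c⊑d u) (ρcw-mono c⊑d u)

module _ {m} (ID : Fin (suc m) → ℕ) where

  queue-persists : ∀ ev c x → ev ≢ step x → queue c x ≤ queue (apply ID ev c) x
  queue-persists (deliver i) c x _ with deliverStep i c | deliverView i c
  ... | _ | empty _ = ≤-refl
  ... | _ | moves _ = update-suc-≥ (queue c) i x
  queue-persists (step i) c x ev≢step with nodeStep ID i c | stepView ID i c
  ... | _ | starts _     = ≤-refl
  ... | _ | idles _ _    = ≤-refl
  ... | _ | elects _ _ _ = ≤-reflexive (sym (update-≢ (queue c) i (_∸ 1) (ev≢step ∘ cong step ∘ sym)))
  ... | _ | relays _ _ _ = ≤-reflexive (sym (update-≢ (queue c) i (_∸ 1) (ev≢step ∘ cong step ∘ sym)))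

  transit-persists : ∀ ev c x → ev ≢ deliver x → transit c x ≤ transit (apply ID ev c) x
  transit-persists (deliver i) c x ev≢deliver with deliverStep i c | deliverView i c
  ... | _ | empty _ = ≤-refl
  ... | _ | moves _ = ≤-reflexive (sym (update-≢ (transit c) i (_∸ 1) (ev≢deliver ∘ cong deliver ∘ sym)))
  transit-persists (step i) c x _ with nodeStep ID i c | stepView ID i c
  ... | _ | starts _     = update-suc-≥ (transit c) (cwNext i) x
  ... | _ | idles _ _    = ≤-refl
  ... | _ | elects _ _ _ = ≤-refl
  ... | _ | relays _ _ _ = update-suc-≥ (transit c) (cwNext i) x

  unstarted-persists : ∀ ev c x → ev ≢ step x → started c x ≡ false → started (apply ID ev c) x ≡ false
  unstarted-persists (deliver i) c x _ unstarted≡ with deliverStep i c | deliverView i c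
  ... | _ | empty _ = unstarted≡
  ... | _ | moves _ = unstarted≡
  unstarted-persists (step i) c x ev≢step unstarted≡ with nodeStep ID i c | stepView ID i c
  ... | _ | starts _     = trans (update-≢ (started c) i _ (ev≢step ∘ cong step ∘ sym)) unstarted≡
  ... | _ | idles _ _    = unstarted≡
  ... | _ | elects _ _ _ = unstarted≡
  ... | _ | relays _ _ _ = unstarted≡

  nodeInvariant-apply : (∀ u → 0 < ID u) → ∀ ev c u → NodeInvariant ID c u → NodeInvariant ID (apply ID ev c) u
  nodeInvariant-apply _ (deliver i) c u inv with deliverStep i c | deliverView i c
  ... | _ | empty _ = inv
  ... | _ | moves _ = inv
  nodeInvariant-apply ID-pos (step i) c = nodeInvariant-step ID-pos (stepView ID i c)

  conservation-apply : ∀ ev c → Conservation c → Conservation (apply ID ev c)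
  conservation-apply (deliver i) c = conservation-deliver (deliverView i c)
  conservation-apply (step i) c    = conservation-step (stepView ID i c)

  arrival-queues : ∀ (c : Config (suc m)) x → 0 < transit c x → 0 < queue (deliverStep x c) x
  arrival-queues c x 0<transit with deliverStep x c | deliverView x c
  ... | _ | empty transit≡0 = contradiction 0<transit (<-irrefl (sym transit≡0))
  ... | _ | moves _         = subst (0 <_) (sym (update-≡ (queue c) x suc)) z<s

  start-dissipates : ∀ c x → started c x ≡ false → potential ID (nodeStep ID x c) < potential ID c
  start-dissipates c x unstarted≡ with nodeStep ID x c | stepView ID x c
  ... | _ | view@(starts _) = potential-strict ID (step-⊑ view) x
    (subst₂ (λ s s' → nodePotential (ID x) s (ρcw c x) < nodePotential (ID x) s' (ρcw c x))
            (sym (update-≡ (started c) x _)) (sym unstarted≡) ≤-refl)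
  ... | _ | idles started≡ _    = contradiction (trans (sym started≡) unstarted≡) λ ()
  ... | _ | elects started≡ _ _ = contradiction (trans (sym started≡) unstarted≡) λ ()
  ... | _ | relays started≡ _ _ = contradiction (trans (sym started≡) unstarted≡) λ ()

  consume-dissipates : ∀ c x → started c x ≡ true → 0 < queue c x → ρcw c x < ID x →
                       potential ID (nodeStep ID x c) < potential ID c
  consume-dissipates c x started≡ 0<queue ρ<ID with nodeStep ID x c | stepView ID x c
  ... | _ | starts unstarted≡   = contradiction (trans (sym started≡) unstarted≡) λ ()
  ... | _ | idles _ queue≡0     = contradiction 0<queue (<-irrefl (sym queue≡0))
  ... | _ | view@(elects _ _ _) = potential-strict ID (step-⊑ view) x (nodePotential-consume (ρcw c) x started≡ ρ<ID)
  ... | _ | view@(relays _ _ _) = potential-strict ID (step-⊑ view) x (nodePotential-consume (ρcw c) x started≡ ρ<ID)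

  saturated-forwards : ∀ c x → started c x ≡ true → 0 < queue c x → ID x ≤ ρcw c x →
                       0 < transit (nodeStep ID x c) (cwNext x)
  saturated-forwards c x started≡ 0<queue ID≤ρ with nodeStep ID x c | stepView ID x c
  ... | _ | starts unstarted≡  = contradiction (trans (sym started≡) unstarted≡) λ ()
  ... | _ | idles _ queue≡0    = contradiction 0<queue (<-irrefl (sym queue≡0))
  ... | _ | elects _ _ 1+ρ≡ID  = contradiction (≤-trans (≤-reflexive 1+ρ≡ID) ID≤ρ) 1+n≰n
  ... | _ | relays _ _ _       = subst (0 <_) (sym (update-≡ (transit c) (cwNext x) suc)) z<s

Pending : ∀ {n} → Config n → Fin n → Set
Pending c x = started c x ≡ false ⊎ 0 < transit c x ⊎ 0 < queue c x

pending? : ∀ {n} (c : Config n) x → Dec (Pending c x)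
pending? c x = (started c x ≟ᵇ false) ⊎-dec (0 <? transit c x) ⊎-dec (0 <? queue c x)

Quiescent : ∀ {n} → Config n → Set
Quiescent c = ∀ x → ¬ Pending c x

quiescent⇒saturated : ∀ {m} (ID : Fin (suc m) → ℕ) (c : Config (suc m)) → (∀ u → NodeInvariant ID c u) →
                      Conservation c → Quiescent c → ∀ v → ID v ≤ ρcw c v
quiescent⇒saturated ID c inv conserved quiescent v =
  ≮⇒≥ λ ρ<ID → 1+n≰n (subst (_≤ ρcw c v)
                             (trans (received≡sent v) (nodeInv-below (all-started v) ρ<ID (inv v)))
                             (ring-no-ascent (ρcw c) nondecreasing v))
  where
  all-started : ∀ u → started c u ≡ true
  all-started u with started c u in started≡
  ... | true  = refl
  ... | false = contradiction (inj₁ started≡) (quiescent u)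

  no-transit : ∀ w → transit c w ≡ 0
  no-transit w = n≤0⇒n≡0 (≮⇒≥ (quiescent w ∘ inj₂ ∘ inj₁))

  no-queue : ∀ w → queue c w ≡ 0
  no-queue w = n≤0⇒n≡0 (≮⇒≥ (quiescent w ∘ inj₂ ∘ inj₂))

  received≡sent : ∀ u → ρcw c (cwNext u) ≡ σcw c u
  received≡sent u =
    trans (cong₂ (λ t q → t + q + ρcw c (cwNext u)) (sym (no-transit _)) (sym (no-queue _))) (conserved u)

  nondecreasing : ∀ u → ρcw c u ≤ ρcw c (cwNext u)
  nondecreasing u = subst (ρcw c u ≤_) (sym (received≡sent u)) (nodeInv-sent≥received (inv u))

-- Executions

earliest : ∀ {P E : ℕ → Set} → (∀ s → Dec (E s)) → (∀ s → ¬ E s → P s → P (suc s)) →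
           ∀ {t t₁} → t ≤ t₁ → E t₁ → P t → ∃ λ s → t ≤ s × E s × P s
earliest {P} {E} E? persists {t} {t₁} t≤t₁ Et₁ = search (t₁ ∸ t) (subst E (sym (m∸n+n≡m t≤t₁)) Et₁)
  where
  search : ∀ k {s} → E (k + s) → P s → ∃ λ s' → s ≤ s' × E s' × P s'
  search zero Es Ps = _ , ≤-refl , Es , Ps
  search (suc k) {s} Ek+s Ps with E? s
  ... | yes Es = s , ≤-refl , Es , Ps
  ... | no ¬Es with search k (subst E (sym (+-suc k s)) Ek+s) (persists s ¬Es Ps)
  ...   | s' , 1+s≤s' , Es' , Ps' = s' , ≤-trans (n≤1+n s) 1+s≤s' , Es' , Ps'

is-step? : ∀ {n} (ev : Event n) x → Dec (ev ≡ step x)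
is-step? (deliver _) x = no λ ()
is-step? (step i)    x = map′ (cong step) (λ { refl → refl }) (i ≟ x)

is-deliver? : ∀ {n} (ev : Event n) x → Dec (ev ≡ deliver x)
is-deliver? (deliver i) x = map′ (cong deliver) (λ { refl → refl }) (i ≟ x)
is-deliver? (step _)    x = no λ ()

module Execution {m} (ID : Fin (suc m) → ℕ) (ID-pos : ∀ u → 0 < ID u)
                 (e : ℕ → Event (suc m)) (fair : Fair ID e) (v : Fin (suc m)) where
  open Fair fair

  R : ℕ → Config (suc m)
  R = run ID e

  Φ : ℕ → ℕ
  Φ t = potential ID (R t)

  invariant : ∀ t u → NodeInvariant ID (R t) u
  invariant zero    u = unstarted
  invariant (suc t) u = nodeInvariant-apply ID ID-pos (e t) (R t) u (invariant t u)

  conserved : ∀ t → Conservation (R t)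
  conserved zero    u = refl
  conserved (suc t)   = conservation-apply ID (e t) (R t) (conserved t)

  R-mono : ∀ {t t'} → t ≤′ t' → R t ⊑ R t'
  R-mono ≤′-refl         = ⊑-refl
  R-mono (≤′-step t≤t') = ⊑-trans (R-mono t≤t') (apply-⊑ ID (e _) _)

  Φ-anti : ∀ {t t'} → t ≤ t' → Φ t' ≤ Φ t
  Φ-anti = potential-anti ID ∘ R-mono ∘ ≤⇒≤′

  R-step : ∀ {s x} → e s ≡ step x → R (suc s) ≡ nodeStep ID x (R s)
  R-step {s} e≡step = cong (λ ev → apply ID ev (R s)) e≡step

  R-deliver : ∀ {s x} → e s ≡ deliver x → R (suc s) ≡ deliverStep x (R s)
  R-deliver {s} e≡deliver = cong (λ ev → apply ID ev (R s)) e≡deliver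

  first-step : ∀ {P : ℕ → Set} x t → (∀ s → e s ≢ step x → P s → P (suc s)) → P t →
               ∃ λ s → t ≤ s × e s ≡ step x × P s
  first-step x t persists Pt with nodesFair x t
  ... | t₁ , t≤t₁ , e≡step = earliest (λ s → is-step? (e s) x) persists t≤t₁ e≡step Pt

  Dissipates : ℕ → Set
  Dissipates t = ∃ λ t' → Φ t' < Φ t

  Saturated : Set
  Saturated = ∃ λ t → ID v ≤ ρcw (R t) v

  Relays : ℕ → Fin (suc m) → Set
  Relays t x = ∃ λ t' → t ≤ t' × ID x ≤ ρcw (R t') x × Pending (R t') (cwNext x)

  dissipates-by-step : ∀ {t s x} → t ≤ s → e s ≡ step x →
                       potential ID (nodeStep ID x (R s)) < potential ID (R s) → Dissipates t
  dissipates-by-step {t} {s} {x} t≤s e≡step dropped = suc s , (begin-strict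
    Φ (suc s)                           ≡⟨ cong (potential ID) (R-step e≡step) ⟩
    potential ID (nodeStep ID x (R s))  <⟨ dropped ⟩
    Φ s                                 ≤⟨ Φ-anti t≤s ⟩
    Φ t                                 ∎)
    where open ≤-Reasoning

  dissipates-later : ∀ {t t'} → t ≤ t' → Dissipates t' → Dissipates t
  dissipates-later t≤t' (t'' , dropped) = t'' , <-≤-trans dropped (Φ-anti t≤t')

  hop-later : ∀ {t t' x} → t ≤ t' → Dissipates t' ⊎ Relays t' x → Dissipates t ⊎ Relays t x
  hop-later t≤t' (inj₁ dissipates) = inj₁ (dissipates-later t≤t' dissipates)
  hop-later t≤t' (inj₂ (t'' , t'≤t'' , relay)) = inj₂ (t'' , ≤-trans t≤t' t'≤t'' , relay)

  hop-unstarted : ∀ t x → started (R t) x ≡ false → Dissipates t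
  hop-unstarted t x unstarted≡
    with first-step x t (λ s ¬step → unstarted-persists ID (e s) (R s) x ¬step) unstarted≡
  ... | s , t≤s , e≡step , unstarted≡ₛ =
    dissipates-by-step t≤s e≡step (start-dissipates ID (R s) x unstarted≡ₛ)

  still-queued : ∀ x s → e s ≢ step x → started (R s) x ≡ true × 0 < queue (R s) x →
                 started (R (suc s)) x ≡ true × 0 < queue (R (suc s)) x
  still-queued x s ¬step (started≡ , 0<queue) =
    started-kept (apply-⊑ ID (e s) (R s)) x started≡ , <-≤-trans 0<queue (queue-persists ID (e s) (R s) x ¬step)

  hop-queued : ∀ t x → started (R t) x ≡ true → 0 < queue (R t) x → Dissipates t ⊎ Relays t x
  hop-queued t x started≡ 0<queue with first-step x t (still-queued x) (started≡ , 0<queue)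
  ... | s , t≤s , e≡step , started≡ₛ , 0<queueₛ with ρcw (R s) x <? ID x
  ...   | yes ρ<ID =
    inj₁ (dissipates-by-step t≤s e≡step (consume-dissipates ID (R s) x started≡ₛ 0<queueₛ ρ<ID))
  ...   | no ρ≮ID  = inj₂ (suc s , m≤n⇒m≤1+n t≤s , ID≤ρ' , inj₂ (inj₁ forwarded))
    where
    ID≤ρ : ID x ≤ ρcw (R s) x
    ID≤ρ = ≮⇒≥ ρ≮ID
    ID≤ρ' : ID x ≤ ρcw (R (suc s)) x
    ID≤ρ' = ≤-trans ID≤ρ (ρcw-mono (apply-⊑ ID (e s) (R s)) x)
    forwarded : 0 < transit (R (suc s)) (cwNext x)
    forwarded = subst (λ c → 0 < transit c (cwNext x)) (sym (R-step e≡step))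
                      (saturated-forwards ID (R s) x started≡ₛ 0<queueₛ ID≤ρ)

  hop-in-transit : ∀ t x → started (R t) x ≡ true → 0 < transit (R t) x → Dissipates t ⊎ Relays t x
  hop-in-transit t x started≡ 0<transit with deliveryFair x t 0<transit
  ... | t₁ , t≤t₁ , e≡deliver
    with earliest (λ s → is-deliver? (e s) x)
                  (λ s ¬deliver 0<transitₛ → <-≤-trans 0<transitₛ (transit-persists ID (e s) (R s) x ¬deliver))
                  t≤t₁ e≡deliver 0<transit
  ...   | s , t≤s , e≡deliverₛ , 0<transitₛ = hop-later t≤1+s (hop-queued (suc s) x
            (started-kept (R-mono (≤⇒≤′ t≤1+s)) x started≡)
            (subst (λ c → 0 < queue c x) (sym (R-deliver e≡deliverₛ)) (arrival-queues ID (R s) x 0<transitₛ)))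
    where
    t≤1+s : t ≤ suc s
    t≤1+s = m≤n⇒m≤1+n t≤s

  hop : ∀ t x → Pending (R t) x → Dissipates t ⊎ Relays t x
  hop t x pending with started (R t) x in started≡ | pending
  ... | false | _                    = inj₁ (hop-unstarted t x started≡)
  ... | true  | inj₂ (inj₁ 0<transit) = hop-in-transit t x started≡ 0<transit
  ... | true  | inj₂ (inj₂ 0<queue)   = hop-queued t x started≡ 0<queue

  chase : ∀ d t x → cwNext^ d x ≡ v → Pending (R t) x → Dissipates t ⊎ Saturated
  chase d t x reaches pending with hop t x pending | d
  ... | inj₁ dissipates                        | _      = inj₁ dissipates
  ... | inj₂ (t' , _ , ID≤ρ , _)               | zero   = inj₂ (t' , subst (λ y → ID y ≤ ρcw (R t') y) reaches ID≤ρ)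
  ... | inj₂ (t' , t≤t' , _ , pending-next)    | suc d' =
    map₁ (dissipates-later t≤t') (chase d' t' (cwNext x) reaches pending-next)

  progress : ∀ t → Dissipates t ⊎ Saturated
  progress t with ID v ≤? ρcw (R t) v
  ... | yes ID≤ρ = inj₂ (t , ID≤ρ)
  ... | no ID≰ρ with any? (pending? (R t))
  ...   | yes (x , pending) = let d , reaches = cwNext^-reaches x v in chase d t x reaches pending
  ...   | no none =
    contradiction (quiescent⇒saturated ID (R t) (invariant t) (conserved t) (λ x p → none (x , p)) v) ID≰ρ

lemma3p7 : (m : ℕ) (ID : Fin (suc m) → ℕ) → Injective _≡_ _≡_ ID → (∀ v → 0 < ID v) →
           (e : ℕ → Event (suc m)) → Fair ID e →
           ∀ (v : Fin (suc m)) → Σ ℕ (λ t → ID v ≤ ρcw (run ID e t) v)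
lemma3p7 m ID _ ID-pos e fair v = climb 0 (<-wellFounded (Φ 0))
  where
  open Execution ID ID-pos e fair v
  climb : ∀ t → Acc _<_ (Φ t) → Saturated
  climb t (acc smaller) with progress t
  ... | inj₁ (t' , Φt'<Φt) = climb t' (smaller Φt'<Φt)
  ... | inj₂ saturated     = saturated
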